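{- Let $K\ge 1$ and $I\ge 1$ be integers, and let $\mathcal{C}^K_I$ denote the set of $2\times I$ matrices with nonnegative integer entries whose two rows each sum to $K$, taken up to the equivalence generated by permuting the two rows and permuting the $I$ columns. Then for every $I\geq 2K$, $|\mathcal{C}^K_I| = |\mathcal{C}^K_{2K}|$.
   Context: An unordered draw of size $K$ with replacement from $I$ labeled objects $A_1,\dots,A_I$ is encoded by a count vector $\mathbf{g}=(g^{(1)},\dots,g^{(I)})\in\mathbb{Z}_{\ge0}^I$ with $\sum_i g^{(i)}=K$. An ordered pair of such draws is the $2\times I$ matrix with rows $\mathbf{g}_1,\mathbf{g}_2$. The group $S_2\times S_I$ acts on these matrices by permuting rows ($S_2$) and columns ($S_I$, i.e., relabeling the objects); $\mathcal{C}^K_I$ is the set of orbits ("identity states"). -}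

module Defs where

open import Data.Nat using (ℕ; _*_)
open import Data.Fin using (Fin)
open import Data.Vec using (Vec; lookup; tabulate; sum)
open import Data.Product using (Σ; ∃; _×_; _,_; proj₁)
open import Data.Sum using (_⊎_)
open import Data.Fin.Permutation using (Permutation′; _⟨$⟩ʳ_)
open import Relation.Binary.PropositionalEquality using (_≡_)
open import Relation.Binary.Bundles using (Setoid)
open import Relation.Binary.Core using (Rel)
import Relation.Binary.Construct.Closure.Equivalence as EqC
open import Level using (0ℓ)

Rows : ℕ → Set
Rows I = Vec ℕ I × Vec ℕ I

-- 2×I nonnegative integer matrices whose two rows each sum to K
-- (ordered pairs of unordered size-K draws from I objects).
Mat : ℕ → ℕ → Set
Mat K I = Σ (Rows I) λ rs → sum (proj₁ rs) ≡ K × sum (Data.Product.proj₂ rs) ≡ K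

permCols : ∀ {I} → Permutation′ I → Vec ℕ I → Vec ℕ I
permCols σ v = tabulate λ j → lookup v (σ ⟨$⟩ʳ j)

Move : ∀ {K I} → Rel (Mat K I) 0ℓ
Move {K} {I} ((r₁ , r₂) , _) ((s₁ , s₂) , _) =
  (s₁ ≡ r₂ × s₂ ≡ r₁)
  ⊎ ∃ λ (σ : Permutation′ I) → s₁ ≡ permCols σ r₁ × s₂ ≡ permCols σ r₂

𝒞 : ℕ → ℕ → Setoid 0ℓ 0ℓ
𝒞 K I = EqC.setoid (Move {K} {I})

-- A 2×I matrix with row sums K has at most 2K nonzero columns,
-- so for I > 2K it has a zero column.  Deleting a zero column is well
-- defined on orbits (all zero columns look alike, and a column permutation
-- carries zero columns to zero columns), and it is inverse to adjoining a
-- zero column.  Hence 𝒞^K_(I+1) ≅ 𝒞^K_I for every I ≥ 2K.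
module Submission where

open import Defs
open import Data.Nat using (ℕ; zero; suc; _+_; _*_; _∸_; _≤_; s≤s; z≤n)
open import Data.Nat.Properties
  using (≤-refl; ≤-trans; ≤-reflexive; m≤n+m; ≤⇒≯; +-identityʳ; m+n≡0⇒m≡0; m+n≡0⇒n≡0; m∸n+n≡m; +-commutativeSemigroup)
open import Algebra.Properties.CommutativeSemigroup +-commutativeSemigroup using (interchange)
open import Data.Fin as Fin using (Fin; punchIn; _≟_)
open import Data.Vec using (Vec; []; _∷_; lookup; sum; removeAt; zipWith)
open import Data.Vec.Properties using (lookup∘tabulate; lookup-zipWith; tabulate∘lookup; tabulate-cong)
open import Data.Product using (∃; _×_; _,_; proj₁; proj₂)
open import Data.Sum using (_⊎_; inj₁; inj₂)
open import Data.Fin.Permutation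
  using (Permutation′; _⟨$⟩ʳ_; remove; insert; lift₀; transpose; _∘ₚ_; insert-punchIn; punchIn-permute)
import Data.Fin.Permutation as Permutation
import Data.Fin.Permutation.Components as PC
open import Function.Bundles using (Inverse)
import Function.Construct.Composition as Composition
import Function.Construct.Identity as Identity
open import Relation.Binary.PropositionalEquality
  using (_≡_; refl; sym; trans; cong; cong₂; subst; module ≡-Reasoning)
open import Relation.Binary.Bundles using (Setoid)
import Relation.Binary.Construct.Closure.Equivalence as EqC
open import Relation.Nullary using (yes; no; contradiction)

private
  variable
    A : Set
    n : ℕ

lookup-removeAt : (v : Vec A (suc n)) (i : Fin (suc n)) (j : Fin n) →
                  lookup (removeAt v i) j ≡ lookup v (punchIn i j)
lookup-removeAt (x ∷ v)     Fin.zero    j           = refl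
lookup-removeAt (x ∷ y ∷ v) (Fin.suc i) Fin.zero    = refl
lookup-removeAt (x ∷ y ∷ v) (Fin.suc i) (Fin.suc j) = lookup-removeAt (y ∷ v) i j

sum-removeAt-zero : (v : Vec ℕ (suc n)) (i : Fin (suc n)) → lookup v i ≡ 0 →
                    sum (removeAt v i) ≡ sum v
sum-removeAt-zero (x ∷ v)     Fin.zero    refl = refl
sum-removeAt-zero (x ∷ y ∷ v) (Fin.suc i) vᵢ≡0 = cong (x +_) (sum-removeAt-zero (y ∷ v) i vᵢ≡0)

sum-zipWith-+ : (u v : Vec ℕ n) → sum (zipWith _+_ u v) ≡ sum u + sum v
sum-zipWith-+ []      []      = refl
sum-zipWith-+ (x ∷ u) (y ∷ v) = trans (cong (x + y +_) (sum-zipWith-+ u v)) (interchange x y (sum u) (sum v))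

zero∈⊎length≤sum : (v : Vec ℕ n) → (∃ λ i → lookup v i ≡ 0) ⊎ n ≤ sum v
zero∈⊎length≤sum []          = inj₂ z≤n
zero∈⊎length≤sum (zero  ∷ v) = inj₁ (Fin.zero , refl)
zero∈⊎length≤sum (suc x ∷ v) with zero∈⊎length≤sum v
... | inj₁ (i , vᵢ≡0) = inj₁ (Fin.suc i , vᵢ≡0)
... | inj₂ n≤sum      = inj₂ (s≤s (≤-trans n≤sum (m≤n+m (sum v) x)))

-- A record rather than a Π-type, so that u and w can be inferred from it.
record PermutedBy (σ : Permutation′ n) (u w : Vec A n) : Set where
  constructor permutedBy
  field lookup-permuted : ∀ j → lookup w j ≡ lookup u (σ ⟨$⟩ʳ j)
open PermutedBy

permutedBy⇒≡permCols : ∀ {σ : Permutation′ n} {u w : Vec ℕ n} → PermutedBy σ u w → w ≡ permCols σ u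
permutedBy⇒≡permCols {w = w} (permutedBy u→w) = trans (sym (tabulate∘lookup w)) (tabulate-cong u→w)

≡permCols⇒permutedBy : ∀ {σ : Permutation′ n} {u w : Vec ℕ n} → w ≡ permCols σ u → PermutedBy σ u w
≡permCols⇒permutedBy refl = permutedBy (lookup∘tabulate _)

permutedBy-trans : ∀ {σ τ : Permutation′ n} {u v w : Vec A n} →
                   PermutedBy σ u v → PermutedBy τ v w → PermutedBy (τ ∘ₚ σ) u w
permutedBy-trans {σ = σ} {τ} (permutedBy u→v) (permutedBy v→w) =
  permutedBy λ j → trans (v→w j) (u→v (τ ⟨$⟩ʳ j))

permutedBy-transpose : (u : Vec A n) {i j : Fin n} → lookup u i ≡ lookup u j →
                       PermutedBy (transpose i j) u u
permutedBy-transpose u {i} {j} uᵢ≡uⱼ = permutedBy swapped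
  where
  swapped : ∀ k → lookup u k ≡ lookup u (PC.transpose i j k)
  swapped k with k ≟ i
  ... | yes refl = uᵢ≡uⱼ
  ... | no _ with k ≟ j
  ...   | yes refl = sym uᵢ≡uⱼ
  ...   | no _     = refl

permutedBy-removeAt : ∀ {σ : Permutation′ (suc n)} {u w : Vec A (suc n)} →
                      PermutedBy σ u w → ∀ b →
                      PermutedBy (remove b σ) (removeAt u (σ ⟨$⟩ʳ b)) (removeAt w b)
permutedBy-removeAt {σ = σ} {u} {w} (permutedBy u→w) b = permutedBy λ j → begin
  lookup (removeAt w b) j                                  ≡⟨ lookup-removeAt w b j ⟩
  lookup w (punchIn b j)                                   ≡⟨ u→w (punchIn b j) ⟩
  lookup u (σ ⟨$⟩ʳ punchIn b j)                            ≡⟨ cong (lookup u) (punchIn-permute σ b j) ⟩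
  lookup u (punchIn (σ ⟨$⟩ʳ b) (remove b σ ⟨$⟩ʳ j))        ≡⟨ lookup-removeAt u (σ ⟨$⟩ʳ b) _ ⟨
  lookup (removeAt u (σ ⟨$⟩ʳ b)) (remove b σ ⟨$⟩ʳ j)       ∎
  where open ≡-Reasoning

permutedBy-moveToFront : (u : Vec A (suc n)) (a : Fin (suc n)) {x : A} → x ≡ lookup u a →
                         PermutedBy (insert Fin.zero a Permutation.id) u (x ∷ removeAt u a)
permutedBy-moveToFront u a x≡uₐ = permutedBy moved
  where
  moved : ∀ j → lookup (_ ∷ removeAt u a) j ≡ lookup u (insert Fin.zero a Permutation.id ⟨$⟩ʳ j)
  moved Fin.zero    = x≡uₐ
  moved (Fin.suc k) =
    trans (lookup-removeAt u a k) (cong (lookup u) (sym (insert-punchIn Fin.zero a Permutation.id k)))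

module _ {K : ℕ} where

  row₁ row₂ : Mat K n → Vec ℕ n
  row₁ x = proj₁ (proj₁ x)
  row₂ x = proj₂ (proj₁ x)

  infix 4 _≃_
  _≃_ : Mat K n → Mat K n → Set
  _≃_ {n} = Setoid._≈_ (𝒞 K n)

  ≃-sym : {x y : Mat K n} → x ≃ y → y ≃ x
  ≃-sym = Setoid.sym (𝒞 K _)

  ≃-trans : {x y z : Mat K n} → x ≃ y → y ≃ z → x ≃ z
  ≃-trans = Setoid.trans (𝒞 K _)

  ZeroColumn : Mat K n → Fin n → Set
  ZeroColumn x i = lookup (row₁ x) i ≡ 0 × lookup (row₂ x) i ≡ 0

  ColumnsPermutedBy : Permutation′ n → Mat K n → Mat K n → Set
  ColumnsPermutedBy σ x y = PermutedBy σ (row₁ x) (row₁ y) × PermutedBy σ (row₂ x) (row₂ y)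

  columnsPermutedBy-id : (x : Mat K n) → ColumnsPermutedBy Permutation.id x x
  columnsPermutedBy-id x = permutedBy (λ _ → refl) , permutedBy (λ _ → refl)

  columnsPermutedBy⇒≃ : ∀ {σ : Permutation′ n} (x y : Mat K n) → ColumnsPermutedBy σ x y → x ≃ y
  columnsPermutedBy⇒≃ {σ = σ} _ _ (x→y₁ , x→y₂) =
    EqC.return (inj₂ (σ , permutedBy⇒≡permCols x→y₁ , permutedBy⇒≡permCols x→y₂))

  deleteColumn : (x : Mat K (suc n)) → ∃ (ZeroColumn x) → Mat K n
  deleteColumn ((u , v) , sumu≡K , sumv≡K) (i , uᵢ≡0 , vᵢ≡0) =
    (removeAt u i , removeAt v i)
    , trans (sum-removeAt-zero u i uᵢ≡0) sumu≡K , trans (sum-removeAt-zero v i vᵢ≡0) sumv≡K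

  consZeroColumn : Mat K n → Mat K (suc n)
  consZeroColumn ((u , v) , sumu≡K , sumv≡K) = (0 ∷ u , 0 ∷ v) , sumu≡K , sumv≡K

  columnsPermutedBy-deleteColumn :
    ∀ {σ : Permutation′ (suc n)} {x y : Mat K (suc n)} {a b} → ColumnsPermutedBy σ x y → σ ⟨$⟩ʳ b ≡ a →
    (za : ZeroColumn x a) (zb : ZeroColumn y b) →
    ColumnsPermutedBy (remove b σ) (deleteColumn x (a , za)) (deleteColumn y (b , zb))
  columnsPermutedBy-deleteColumn {b = b} (x→y₁ , x→y₂) refl _ _ =
    permutedBy-removeAt x→y₁ b , permutedBy-removeAt x→y₂ b

  -- Precompose σ with the transposition of σ b and a: it still carries x to y
  -- (both columns of x are zero) and now sends b to a.
  deleteColumn-≃ : ∀ {σ : Permutation′ (suc n)} (x y : Mat K (suc n)) → ColumnsPermutedBy σ x y →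
                   (za : ∃ (ZeroColumn x)) (zb : ∃ (ZeroColumn y)) → deleteColumn x za ≃ deleteColumn y zb
  deleteColumn-≃ {σ = σ} x y (x→y₁ , x→y₂) (a , za@(x₁ₐ≡0 , x₂ₐ≡0)) (b , zb@(y₁b≡0 , y₂b≡0)) =
    columnsPermutedBy⇒≃ _ _ (columnsPermutedBy-deleteColumn {x = x} {y} x→y moved-b za zb)
    where
    τ = transpose (σ ⟨$⟩ʳ b) a
    x→y : ColumnsPermutedBy (σ ∘ₚ τ) x y
    x→y = permutedBy-trans (permutedBy-transpose (row₁ x) (equalEntries x→y₁ y₁b≡0 x₁ₐ≡0)) x→y₁
        , permutedBy-trans (permutedBy-transpose (row₂ x) (equalEntries x→y₂ y₂b≡0 x₂ₐ≡0)) x→y₂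
      where
      equalEntries : ∀ {u w} → PermutedBy σ u w → lookup w b ≡ 0 → lookup u a ≡ 0 →
                     lookup u (σ ⟨$⟩ʳ b) ≡ lookup u a
      equalEntries u→w w_b≡0 uₐ≡0 = trans (sym (lookup-permuted u→w b)) (trans w_b≡0 (sym uₐ≡0))
    moved-b : (σ ∘ₚ τ) ⟨$⟩ʳ b ≡ a
    moved-b with σ ⟨$⟩ʳ b ≟ σ ⟨$⟩ʳ b
    ... | yes _ = refl
    ... | no σb≢σb = contradiction refl σb≢σb

  zeroColumn : 2 * K ≤ n → (x : Mat K (suc n)) → ∃ (ZeroColumn x)
  zeroColumn 2K≤n ((u , v) , sumu≡K , sumv≡K) with zero∈⊎length≤sum (zipWith _+_ u v)
  ... | inj₁ (i , uᵢ+vᵢ≡0) = i , m+n≡0⇒m≡0 _ uᵢ+vᵢ≡0′ , m+n≡0⇒n≡0 _ uᵢ+vᵢ≡0′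
    where uᵢ+vᵢ≡0′ = trans (sym (lookup-zipWith _+_ i u v)) uᵢ+vᵢ≡0
  ... | inj₂ 1+n≤columnSum = contradiction (≤-trans 1+n≤columnSum (≤-reflexive columnSum≡2K)) (≤⇒≯ 2K≤n)
    where columnSum≡2K = trans (sum-zipWith-+ u v) (cong₂ _+_ sumu≡K (trans sumv≡K (sym (+-identityʳ K))))

  dropZeroColumn : 2 * K ≤ n → Mat K (suc n) → Mat K n
  dropZeroColumn 2K≤n x = deleteColumn x (zeroColumn 2K≤n x)

  dropZeroColumn-move : (2K≤n : 2 * K ≤ n) {x y : Mat K (suc n)} →
                        Move x y → dropZeroColumn 2K≤n x ≃ dropZeroColumn 2K≤n y
  dropZeroColumn-move 2K≤n {x} {y} (inj₁ (refl , refl)) with zeroColumn 2K≤n x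
  ... | a , x₁ₐ≡0 , x₂ₐ≡0 =
    ≃-trans (EqC.return (inj₁ (refl , refl)))
            (deleteColumn-≃ y y (columnsPermutedBy-id y) (a , x₂ₐ≡0 , x₁ₐ≡0) (zeroColumn 2K≤n y))
  dropZeroColumn-move 2K≤n {x} {y} (inj₂ (σ , y₁≡σx₁ , y₂≡σx₂)) =
    deleteColumn-≃ x y (≡permCols⇒permutedBy {σ = σ} y₁≡σx₁ , ≡permCols⇒permutedBy {σ = σ} y₂≡σx₂)
                   (zeroColumn 2K≤n x) (zeroColumn 2K≤n y)

  consZeroColumn-move : {x y : Mat K n} → Move x y → Move (consZeroColumn x) (consZeroColumn y)
  consZeroColumn-move (inj₁ (s₁≡r₂ , s₂≡r₁))     = inj₁ (cong (0 ∷_) s₁≡r₂ , cong (0 ∷_) s₂≡r₁)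
  consZeroColumn-move (inj₂ (σ , s₁≡σr₁ , s₂≡σr₂)) = inj₂ (lift₀ σ , cong (0 ∷_) s₁≡σr₁ , cong (0 ∷_) s₂≡σr₂)

  dropZeroColumn-consZeroColumn : (2K≤n : 2 * K ≤ n) (x : Mat K n) → dropZeroColumn 2K≤n (consZeroColumn x) ≃ x
  dropZeroColumn-consZeroColumn 2K≤n x =
    ≃-trans (deleteColumn-≃ x₀ x₀ (columnsPermutedBy-id x₀) (zeroColumn 2K≤n x₀) (Fin.zero , refl , refl))
            (columnsPermutedBy⇒≃ _ x (columnsPermutedBy-id x))
    where x₀ = consZeroColumn x

  consZeroColumn-dropZeroColumn : (2K≤n : 2 * K ≤ n) (x : Mat K (suc n)) → consZeroColumn (dropZeroColumn 2K≤n x) ≃ x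
  consZeroColumn-dropZeroColumn 2K≤n x with zeroColumn 2K≤n x
  ... | a , x₁ₐ≡0 , x₂ₐ≡0 = ≃-sym (columnsPermutedBy⇒≃ x _
    (permutedBy-moveToFront (row₁ x) a (sym x₁ₐ≡0) , permutedBy-moveToFront (row₂ x) a (sym x₂ₐ≡0)))

  𝒞-suc-inverse : 2 * K ≤ n → Inverse (𝒞 K (suc n)) (𝒞 K n)
  𝒞-suc-inverse {n} 2K≤n = record
    { to        = dropZeroColumn 2K≤n
    ; from      = consZeroColumn
    ; to-cong   = dropZeroColumn-cong
    ; from-cong = consZeroColumn-cong
    ; inverse   = (λ {x} y≃cons-x →
                     ≃-trans (dropZeroColumn-cong y≃cons-x) (dropZeroColumn-consZeroColumn 2K≤n x))
                , (λ {x} y≃drop-x →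
                     ≃-trans (consZeroColumn-cong y≃drop-x) (consZeroColumn-dropZeroColumn 2K≤n x))
    }
    where
    dropZeroColumn-cong : {x y : Mat K (suc n)} → x ≃ y → dropZeroColumn 2K≤n x ≃ dropZeroColumn 2K≤n y
    dropZeroColumn-cong = EqC.gfold (Setoid.isEquivalence (𝒞 K n)) (dropZeroColumn 2K≤n) (dropZeroColumn-move 2K≤n)

    consZeroColumn-cong : {x y : Mat K n} → x ≃ y → consZeroColumn x ≃ consZeroColumn y
    consZeroColumn-cong = EqC.gmap consZeroColumn (λ {x} {y} → consZeroColumn-move {n} {x} {y})

𝒞-stable : ∀ {K m} → 2 * K ≤ m → ∀ d → Inverse (𝒞 K (d + m)) (𝒞 K m)
𝒞-stable         2K≤m zero    = Identity.inverse _
𝒞-stable {m = m} 2K≤m (suc d) = Composition.inverse (𝒞-suc-inverse (≤-trans 2K≤m (m≤n+m m d))) (𝒞-stable 2K≤m d)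

lemma1 : (K I : ℕ) → 1 ≤ K → 1 ≤ I → 2 * K ≤ I → Inverse (𝒞 K I) (𝒞 K (2 * K))
lemma1 K I _ _ 2K≤I =
  subst (λ i → Inverse (𝒞 K i) (𝒞 K (2 * K))) (m∸n+n≡m 2K≤I) (𝒞-stable ≤-refl (I ∸ 2 * K))
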